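{- For every $m, s \in \mathbb{Z}$ and every positive integer $n$ there exists an integer $D \geq 2$, not a perfect square, such that $D \equiv m \pmod n$ and every universal quadratic form over $\mathbb{Z}[\sqrt{D}]$ has at least $s$ variables.
   Context: For $\alpha = a + b\sqrt{D} \in \mathbb{Z}[\sqrt{D}]$, its conjugate is $\alpha' = a - b\sqrt{D}$; $\alpha$ is totally positive ($\alpha \succ 0$) if $\alpha > 0$ and $\alpha' > 0$. A quadratic form over $\mathbb{Z}[\sqrt{D}]$ in $r$ variables is $Q(x_1,\dots,x_r) = \sum_{1 \le i \le j \le r} \alpha_{ij} x_i x_j$ with $\alpha_{ij} \in \mathbb{Z}[\sqrt{D}]$, the variables ranging over $\mathbb{Z}[\sqrt{D}]$. It is totally positive if $Q(\gamma_1,\dots,\gamma_r) \succ 0$ for all $(\gamma_1,\dots,\gamma_r) \in \mathbb{Z}[\sqrt{D}]^r \setminus \{0\}$. It is universal if it is totally positive and every totally positive $\alpha \in \mathbb{Z}[\sqrt{D}]$ equals $Q(\gamma_1,\dots,\gamma_r)$ for some $\gamma_i \in \mathbb{Z}[\sqrt{D}]$. -}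

module Defs where

open import Data.Integer using (ℤ; +_; _+_; _-_; _*_; -_; _<_; _≤_; 0ℤ)
open import Data.Nat using (ℕ)
import Data.Nat as ℕ
open import Data.Fin using (Fin; toℕ)
open import Data.Product using (_×_; _,_; proj₁; proj₂; Σ; ∃)
open import Data.Sum using (_⊎_)
open import Relation.Nullary using (¬_; does)
open import Relation.Binary.PropositionalEquality using (_≡_)
open import Data.Bool using (if_then_else_)

-- An element a + b√D of ℤ[√D] is represented by the pair (a , b).
ZD : Set
ZD = ℤ × ℤ

zeroD : ZD
zeroD = 0ℤ , 0ℤ

_+D_ : ZD → ZD → ZD
(a , b) +D (c , d) = (a + c) , (b + d)

mulD : ℤ → ZD → ZD → ZD
mulD D (a , b) (c , d) = (a * c + D * (b * d)) , (a * d + b * c)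

conj : ZD → ZD
conj (a , b) = a , - b

IsSquare : ℤ → Set
IsSquare D = ∃ λ k → k * k ≡ D

-- a + b√D > 0 as a real number (for D ≥ 2 not a square), written out
-- without reals:  b ≥ 0 : a > 0 or a² < D b²;   b < 0 : a > 0 and a² > D b².
PosReal : ℤ → ZD → Set
PosReal D (a , b) =
  (0ℤ ≤ b × (0ℤ < a ⊎ a * a < D * (b * b)))
  ⊎ (b < 0ℤ × (0ℤ < a × D * (b * b) < a * a))

TotPos : ℤ → ZD → Set
TotPos D α = PosReal D α × PosReal D (conj α)

ΣFin : (r : ℕ) → (Fin r → ZD) → ZD
ΣFin ℕ.zero f = zeroD
ΣFin (ℕ.suc r) f = f Fin.zero +D ΣFin r (λ i → f (Fin.suc i))

-- A quadratic form in r variables over ℤ[√D]: coefficients α i j, of which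
-- only those with i ≤ j are used:  Q(x) = Σ_{i ≤ j} α_ij x_i x_j.
QForm : ℕ → Set
QForm r = Fin r → Fin r → ZD

evalQ : (D : ℤ) (r : ℕ) → QForm r → (Fin r → ZD) → ZD
evalQ D r α x =
  ΣFin r λ i → ΣFin r λ j →
    if does (toℕ i ℕ.≤? toℕ j)
      then mulD D (α i j) (mulD D (x i) (x j))
      else zeroD

TotPosForm : (D : ℤ) (r : ℕ) → QForm r → Set
TotPosForm D r α =
  (x : Fin r → ZD) → ¬ (∀ i → x i ≡ zeroD) → TotPos D (evalQ D r α x)

Universal : (D : ℤ) (r : ℕ) → QForm r → Set
Universal D r α =
  TotPosForm D r α ×
  ((β : ZD) → TotPos D β → Σ (Fin r → ZD) λ x → evalQ D r α x ≡ β)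

{-# OPTIONS --safe #-}

-- Take D = a² + b with a = n·4^|s| and 1 ≤ b ≤ n, b ≡ m (mod n), so that a² < D < (a + 1)².
-- Let ℓ(p + q√D) = p − a q be the coefficient of 1 in the basis 1, ω = a + √D. As a < √D, ℓ is
-- positive on totally positive elements, and the β_t = 1 + t ω (0 ≤ t < 4^|s|) are totally
-- positive with ℓ(β_t) = 1. If a totally positive form Q takes values β, β′ with ℓ = 1 at vectors
-- v ≡ w (mod 2), write v = x + y, w = x − y: the parallelogram law Q(v) + Q(w) = 2Q(x) + 2Q(y)
-- gives ℓ(Q x) + ℓ(Q y) = 1, so x = 0 or y = 0, and then β = β′ because Q(−y) = Q(y). A universal
-- form in r variables thus represents the β_t at vectors pairwise incongruent mod 2, so
-- 4^|s| ≤ 4^r.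

module Submission where

open import Defs
open import Data.Nat using (ℕ; zero; suc; z≤n; s≤s)
import Data.Nat as ℕ
import Data.Nat.Properties as ℕP
import Data.Nat.Divisibility as ℕDiv
import Data.Nat.Tactic.RingSolver as ℕSolver
open import Data.Integer using (ℤ; +_; +[1+_]; -[1+_]; _+_; _-_; _*_; -_; _≤_; _<_; 0ℤ; ∣_∣; +≤+; +<+; -≤+; -<+)
import Data.Integer.Properties as ℤP
open import Data.Integer.DivMod using (_%ℕ_; _/ℕ_; a≡a%ℕn+[a/ℕn]*n; n%ℕd<d)
open import Data.Integer.Divisibility using (_∣_)
import Data.Integer.Divisibility.Signed as Signed
open import Data.Integer.Tactic.RingSolver using (solve-∀)
open import Algebra.Properties.CommutativeSemigroup ℤP.+-commutativeSemigroup using (interchange)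
open import Data.Fin using (Fin; toℕ; fromℕ<; combine; funToFin; finToFun)
import Data.Fin.Properties as FinP
open import Data.Bool using (Bool; true; false; if_then_else_)
open import Data.Product using (_×_; _,_; proj₁; proj₂; Σ)
open import Data.Product.Properties using (≡-dec)
open import Data.Sum using (inj₁; inj₂)
open import Data.List using (_∷_; [])
open import Function using (_∘_)
open import Function.Definitions using (Injective)
open import Relation.Nullary using (¬_; Dec; yes; no; does; contradiction)
open import Relation.Binary.PropositionalEquality

negD : ZD → ZD
negD (p , q) = - p , - q

_≟D_ : (u v : ZD) → Dec (u ≡ v)
_≟D_ = ≡-dec ℤP._≟_ ℤP._≟_

+D-identityˡ : ∀ u → zeroD +D u ≡ u
+D-identityˡ (p , q) = cong₂ _,_ (ℤP.+-identityˡ p) (ℤP.+-identityˡ q)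

+D-identityʳ : ∀ u → u +D zeroD ≡ u
+D-identityʳ (p , q) = cong₂ _,_ (ℤP.+-identityʳ p) (ℤP.+-identityʳ q)

+D-interchange : ∀ u v w z → (u +D v) +D (w +D z) ≡ (u +D w) +D (v +D z)
+D-interchange (u₁ , u₂) (v₁ , v₂) (w₁ , w₂) (z₁ , z₂) =
  cong₂ _,_ (interchange u₁ v₁ w₁ z₁) (interchange u₂ v₂ w₂ z₂)

+D-negD-cancelʳ : ∀ u v → (u +D v) +D negD v ≡ u
+D-negD-cancelʳ (p , q) (p′ , q′) = cong₂ _,_ (cancel p p′) (cancel q q′)
  where
  cancel : ∀ x y → (x + y) + - y ≡ x
  cancel = solve-∀

mulD-distribˡ-+D : ∀ D a u v → mulD D a (u +D v) ≡ mulD D a u +D mulD D a v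
mulD-distribˡ-+D D (a₁ , a₂) (u₁ , u₂) (v₁ , v₂) =
  cong₂ _,_ (distrib₁ D a₁ a₂ u₁ u₂ v₁ v₂) (distrib₂ a₁ a₂ u₁ u₂ v₁ v₂)
  where
  distrib₁ : ∀ D a₁ a₂ u₁ u₂ v₁ v₂ →
    a₁ * (u₁ + v₁) + D * (a₂ * (u₂ + v₂))
    ≡ (a₁ * u₁ + D * (a₂ * u₂)) + (a₁ * v₁ + D * (a₂ * v₂))
  distrib₁ = solve-∀
  distrib₂ : ∀ a₁ a₂ u₁ u₂ v₁ v₂ →
    a₁ * (u₂ + v₂) + a₂ * (u₁ + v₁) ≡ (a₁ * u₂ + a₂ * u₁) + (a₁ * v₂ + a₂ * v₁)
  distrib₂ = solve-∀

mulD-negD : ∀ D u v → mulD D (negD u) (negD v) ≡ mulD D u v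
mulD-negD D (u₁ , u₂) (v₁ , v₂) = cong₂ _,_ (neg₁ D u₁ u₂ v₁ v₂) (neg₂ u₁ u₂ v₁ v₂)
  where
  neg₁ : ∀ D u₁ u₂ v₁ v₂ → (- u₁) * (- v₁) + D * ((- u₂) * (- v₂)) ≡ u₁ * v₁ + D * (u₂ * v₂)
  neg₁ = solve-∀
  neg₂ : ∀ u₁ u₂ v₁ v₂ → (- u₁) * (- v₂) + (- u₂) * (- v₁) ≡ u₁ * v₂ + u₂ * v₁
  neg₂ = solve-∀

mulD-parallelogram : ∀ D x x′ y y′ →
  mulD D (x +D y) (x′ +D y′) +D mulD D (x +D negD y) (x′ +D negD y′)
  ≡ (mulD D x x′ +D mulD D x x′) +D (mulD D y y′ +D mulD D y y′)
mulD-parallelogram D (x₁ , x₂) (x₁′ , x₂′) (y₁ , y₂) (y₁′ , y₂′) =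
  cong₂ _,_ (parallelogram₁ D x₁ x₂ x₁′ x₂′ y₁ y₂ y₁′ y₂′)
            (parallelogram₂ x₁ x₂ x₁′ x₂′ y₁ y₂ y₁′ y₂′)
  where
  parallelogram₁ : ∀ D x₁ x₂ x₁′ x₂′ y₁ y₂ y₁′ y₂′ →
    ((x₁ + y₁) * (x₁′ + y₁′) + D * ((x₂ + y₂) * (x₂′ + y₂′)))
      + ((x₁ - y₁) * (x₁′ - y₁′) + D * ((x₂ - y₂) * (x₂′ - y₂′)))
    ≡ ((x₁ * x₁′ + D * (x₂ * x₂′)) + (x₁ * x₁′ + D * (x₂ * x₂′)))
      + ((y₁ * y₁′ + D * (y₂ * y₂′)) + (y₁ * y₁′ + D * (y₂ * y₂′)))
  parallelogram₁ = solve-∀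
  parallelogram₂ : ∀ x₁ x₂ x₁′ x₂′ y₁ y₂ y₁′ y₂′ →
    ((x₁ + y₁) * (x₂′ + y₂′) + (x₂ + y₂) * (x₁′ + y₁′))
      + ((x₁ - y₁) * (x₂′ - y₂′) + (x₂ - y₂) * (x₁′ - y₁′))
    ≡ ((x₁ * x₂′ + x₂ * x₁′) + (x₁ * x₂′ + x₂ * x₁′))
      + ((y₁ * y₂′ + y₂ * y₁′) + (y₁ * y₂′ + y₂ * y₁′))
  parallelogram₂ = solve-∀

monomial-parallelogram : ∀ D a x x′ y y′ →
  mulD D a (mulD D (x +D y) (x′ +D y′)) +D mulD D a (mulD D (x +D negD y) (x′ +D negD y′))
  ≡ (mulD D a (mulD D x x′) +D mulD D a (mulD D x x′))
    +D (mulD D a (mulD D y y′) +D mulD D a (mulD D y y′))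
monomial-parallelogram D a x x′ y y′ = begin
  scale (mulD D (x +D y) (x′ +D y′)) +D scale (mulD D (x +D negD y) (x′ +D negD y′))
    ≡⟨ mulD-distribˡ-+D D a _ _ ⟨
  scale (mulD D (x +D y) (x′ +D y′) +D mulD D (x +D negD y) (x′ +D negD y′))
    ≡⟨ cong scale (mulD-parallelogram D x x′ y y′) ⟩
  scale ((mulD D x x′ +D mulD D x x′) +D (mulD D y y′ +D mulD D y y′))
    ≡⟨ mulD-distribˡ-+D D a _ _ ⟩
  scale (mulD D x x′ +D mulD D x x′) +D scale (mulD D y y′ +D mulD D y y′)
    ≡⟨ cong₂ _+D_ (mulD-distribˡ-+D D a _ _) (mulD-distribˡ-+D D a _ _) ⟩
  (scale (mulD D x x′) +D scale (mulD D x x′)) +D (scale (mulD D y y′) +D scale (mulD D y y′)) ∎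
  where
  open ≡-Reasoning
  scale : ZD → ZD
  scale = mulD D a

ΣFin-cong : ∀ r {f g : Fin r → ZD} → (∀ i → f i ≡ g i) → ΣFin r f ≡ ΣFin r g
ΣFin-cong zero    f≗g = refl
ΣFin-cong (suc r) f≗g = cong₂ _+D_ (f≗g Fin.zero) (ΣFin-cong r (f≗g ∘ Fin.suc))

ΣFin-+D : ∀ r (f g : Fin r → ZD) → ΣFin r (λ i → f i +D g i) ≡ ΣFin r f +D ΣFin r g
ΣFin-+D zero    f g = refl
ΣFin-+D (suc r) f g =
  trans (cong ((f Fin.zero +D g Fin.zero) +D_) (ΣFin-+D r (f ∘ Fin.suc) (g ∘ Fin.suc)))
        (+D-interchange (f Fin.zero) (g Fin.zero) _ _)

ΣFin² : ∀ r → (Fin r → Fin r → ZD) → ZD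
ΣFin² r f = ΣFin r λ i → ΣFin r (f i)

ΣFin²-cong : ∀ r {f g : Fin r → Fin r → ZD} → (∀ i j → f i j ≡ g i j) → ΣFin² r f ≡ ΣFin² r g
ΣFin²-cong r f≗g = ΣFin-cong r λ i → ΣFin-cong r (f≗g i)

ΣFin²-+D : ∀ r (f g : Fin r → Fin r → ZD) →
  ΣFin² r (λ i j → f i j +D g i j) ≡ ΣFin² r f +D ΣFin² r g
ΣFin²-+D r f g = trans (ΣFin-cong r λ i → ΣFin-+D r (f i) (g i)) (ΣFin-+D r _ _)

keepIf : Bool → ZD → ZD
keepIf c u = if c then u else zeroD

keepIf-parallelogram : ∀ c {P M X Y} → P +D M ≡ (X +D X) +D (Y +D Y) →
  keepIf c P +D keepIf c M ≡ (keepIf c X +D keepIf c X) +D (keepIf c Y +D keepIf c Y)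
keepIf-parallelogram true  eq = eq
keepIf-parallelogram false _  = refl

evalQ-entry : (D : ℤ) (r : ℕ) → QForm r → (Fin r → ZD) → Fin r → Fin r → ZD
evalQ-entry D r α x i j = keepIf (does (toℕ i ℕ.≤? toℕ j)) (mulD D (α i j) (mulD D (x i) (x j)))

module _ (D : ℤ) (r : ℕ) (α : QForm r) where

  evalQ-cong : ∀ {x y} → (∀ i → x i ≡ y i) → evalQ D r α x ≡ evalQ D r α y
  evalQ-cong {x} {y} x≗y = ΣFin²-cong r λ i j →
    cong₂ (λ u v → keepIf (does (toℕ i ℕ.≤? toℕ j)) (mulD D (α i j) (mulD D u v))) (x≗y i) (x≗y j)

  evalQ-negD : ∀ x → evalQ D r α (negD ∘ x) ≡ evalQ D r α x
  evalQ-negD x = ΣFin²-cong r λ i j →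
    cong (keepIf (does (toℕ i ℕ.≤? toℕ j)) ∘ mulD D (α i j)) (mulD-negD D (x i) (x j))

  evalQ-parallelogram : ∀ x y →
    evalQ D r α (λ i → x i +D y i) +D evalQ D r α (λ i → x i +D negD (y i))
    ≡ (evalQ D r α x +D evalQ D r α x) +D (evalQ D r α y +D evalQ D r α y)
  evalQ-parallelogram x y = begin
    ΣFin² r (entry x+y) +D ΣFin² r (entry x-y)
      ≡⟨ ΣFin²-+D r (entry x+y) (entry x-y) ⟨
    ΣFin² r (λ i j → entry x+y i j +D entry x-y i j)
      ≡⟨ ΣFin²-cong r (λ i j → keepIf-parallelogram (does (toℕ i ℕ.≤? toℕ j))
                                 (monomial-parallelogram D (α i j) (x i) (x j) (y i) (y j))) ⟩
    ΣFin² r (λ i j → (entry x i j +D entry x i j) +D (entry y i j +D entry y i j))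
      ≡⟨ ΣFin²-+D r _ _ ⟩
    ΣFin² r (λ i j → entry x i j +D entry x i j) +D ΣFin² r (λ i j → entry y i j +D entry y i j)
      ≡⟨ cong₂ _+D_ (ΣFin²-+D r (entry x) (entry x)) (ΣFin²-+D r (entry y) (entry y)) ⟩
    (ΣFin² r (entry x) +D ΣFin² r (entry x)) +D (ΣFin² r (entry y) +D ΣFin² r (entry y)) ∎
    where
    open ≡-Reasoning
    entry : (Fin r → ZD) → Fin r → Fin r → ZD
    entry = evalQ-entry D r α
    x+y x-y : Fin r → ZD
    x+y i = x i +D y i
    x-y i = x i +D negD (y i)

ℓ : ℕ → ZD → ℤ
ℓ a (p , q) = p - + a * q

ℓ-distrib-+D : ∀ a u v → ℓ a (u +D v) ≡ ℓ a u + ℓ a v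
ℓ-distrib-+D a (p , q) (p′ , q′) = linear p q p′ q′ (+ a)
  where
  linear : ∀ p q p′ q′ A → (p + p′) - A * (q + q′) ≡ (p - A * q) + (p′ - A * q′)
  linear = solve-∀

m*m<n*n⇒m<n : ∀ {m n} → m ℕ.* m ℕ.< n ℕ.* n → m ℕ.< n
m*m<n*n⇒m<n m*m<n*n = ℕP.≰⇒> λ n≤m → ℕP.<⇒≱ m*m<n*n (ℕP.*-mono-≤ n≤m n≤m)

0≤i*i : ∀ i → 0ℤ ≤ i * i
0≤i*i (+ n)    = subst (0ℤ ≤_) (ℤP.pos-* n n) (+≤+ z≤n)
0≤i*i -[1+ n ] = +≤+ z≤n

i<j⇒0<j-i : ∀ {i j} → i < j → 0ℤ < j - i
i<j⇒0<j-i {i} {j} i<j = subst (_< j - i) (ℤP.+-inverseʳ i) (ℤP.+-monoˡ-< (- i) i<j)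

a²≤d⇒aq<p : ∀ {a d q p} → a ℕ.* a ℕ.≤ d → d ℕ.* (q ℕ.* q) ℕ.< p ℕ.* p → a ℕ.* q ℕ.< p
a²≤d⇒aq<p {a} {d} {q} {p} a²≤d dq²<p² = m*m<n*n⇒m<n (begin-strict
  (a ℕ.* q) ℕ.* (a ℕ.* q) ≡⟨ ℕSolver.solve (a ∷ q ∷ []) ⟩
  (a ℕ.* a) ℕ.* (q ℕ.* q) ≤⟨ ℕP.*-monoˡ-≤ (q ℕ.* q) a²≤d ⟩
  d ℕ.* (q ℕ.* q)         <⟨ dq²<p² ⟩
  p ℕ.* p                 ∎)
  where open ℕP.≤-Reasoning

TotPos⇒aq<p : ∀ a {d} → a ℕ.* a ℕ.≤ d → ∀ p q → TotPos (+ d) (p , q) → + a * q < p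
TotPos⇒aq<p a _ p -[1+ k ] (inj₂ (_ , 0<p , _) , _) =
  ℤP.≤-<-trans (subst (+ a * -[1+ k ] ≤_) (ℤP.*-zeroʳ (+ a)) (ℤP.*-monoˡ-≤-nonNeg (+ a) -≤+)) 0<p
TotPos⇒aq<p _ _ p -[1+ k ] (inj₁ (() , _) , _)
TotPos⇒aq<p a _ p (+ zero) (inj₁ (_ , inj₁ 0<p) , _) = subst (_< p) (sym (ℤP.*-zeroʳ (+ a))) 0<p
TotPos⇒aq<p _ {d} _ p (+ zero) (inj₁ (_ , inj₂ p²<0) , _) =
  contradiction (subst (p * p <_) (ℤP.*-zeroʳ (+ d)) p²<0) (ℤP.≤⇒≯ (0≤i*i p))
TotPos⇒aq<p _ _ p (+ zero) (inj₂ (+<+ () , _) , _)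
TotPos⇒aq<p _ _ p +[1+ k ] (_ , inj₁ (() , _))
TotPos⇒aq<p _ _ -[1+ _ ] +[1+ k ] (_ , inj₂ (_ , () , _))
TotPos⇒aq<p a {d} a²≤d (+ P) +[1+ k ] (_ , inj₂ (_ , _ , dq²<P²)) =
  subst (_< + P) (ℤP.pos-* a (suc k)) (+<+ (a²≤d⇒aq<p {a} a²≤d dq²<P²ℕ))
  where
  dq²<P²ℕ : d ℕ.* (suc k ℕ.* suc k) ℕ.< P ℕ.* P
  dq²<P²ℕ = ℤP.drop‿+<+ (subst₂ _<_ (sym (ℤP.pos-* d _)) (sym (ℤP.pos-* P P)) dq²<P²)

TotPos⇒0<ℓ : ∀ a {d} → a ℕ.* a ℕ.≤ d → ∀ α → TotPos (+ d) α → 0ℤ < ℓ a α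
TotPos⇒0<ℓ a a²≤d (p , q) α≻0 = i<j⇒0<j-i (TotPos⇒aq<p a a²≤d p q α≻0)

parity : ℤ → Fin 2
parity i = fromℕ< (n%ℕd<d i 2)

parityD : ZD → Fin 4
parityD (p , q) = combine (parity p) (parity q)

parityCode : ∀ {r} → (Fin r → ZD) → Fin (4 ℕ.^ r)
parityCode v = funToFin (parityD ∘ v)

parity-≡⇒≡+k+k : ∀ i j → parity i ≡ parity j → Σ ℤ λ k → i ≡ (j + k) + k
parity-≡⇒≡+k+k i j same = i /ℕ 2 - j /ℕ 2 , (begin
  i                                               ≡⟨ a≡a%ℕn+[a/ℕn]*n i 2 ⟩
  + (i %ℕ 2) + (i /ℕ 2) * + 2                     ≡⟨ cong (λ ρ → + ρ + (i /ℕ 2) * + 2) i%2≡j%2 ⟩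
  + (j %ℕ 2) + (i /ℕ 2) * + 2                     ≡⟨ regroup (+ (j %ℕ 2)) (i /ℕ 2) (j /ℕ 2) ⟩
  ((+ (j %ℕ 2) + (j /ℕ 2) * + 2) + δ) + δ         ≡⟨ cong (λ k → (k + δ) + δ) (a≡a%ℕn+[a/ℕn]*n j 2) ⟨
  (j + δ) + δ                                     ∎)
  where
  open ≡-Reasoning
  δ : ℤ
  δ = i /ℕ 2 - j /ℕ 2
  i%2≡j%2 : i %ℕ 2 ≡ j %ℕ 2
  i%2≡j%2 = trans (sym (FinP.toℕ-fromℕ< _)) (trans (cong toℕ same) (FinP.toℕ-fromℕ< _))
  regroup : ∀ ρ x y → ρ + x * + 2 ≡ ((ρ + y * + 2) + (x - y)) + (x - y)
  regroup = solve-∀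

parityD-≡⇒≡+δ+δ : ∀ u v → parityD u ≡ parityD v → Σ ZD λ δ → u ≡ (v +D δ) +D δ
parityD-≡⇒≡+δ+δ (p , q) (p′ , q′) same
  with p≡ , q≡ ← FinP.combine-injective (parity p) (parity q) (parity p′) (parity q′) same
  with k , p-eq ← parity-≡⇒≡+k+k p p′ p≡ | l , q-eq ← parity-≡⇒≡+k+k q q′ q≡
  = (k , l) , cong₂ _,_ p-eq q-eq

CongruentMod2 : ∀ {r} → (Fin r → ZD) → (Fin r → ZD) → Set
CongruentMod2 {r} v w = Σ (Fin r → ZD) λ y → ∀ i → v i ≡ (w i +D y i) +D y i

parityCode-≡⇒CongruentMod2 : ∀ {r} (v w : Fin r → ZD) → parityCode v ≡ parityCode w → CongruentMod2 v w
parityCode-≡⇒CongruentMod2 v w same = proj₁ ∘ halfDifference , proj₂ ∘ halfDifference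
  where
  open ≡-Reasoning
  halfDifference : ∀ i → Σ ZD λ δ → v i ≡ (w i +D δ) +D δ
  halfDifference i = parityD-≡⇒≡+δ+δ (v i) (w i) (begin
    parityD (v i)               ≡⟨ FinP.finToFun-funToFin (parityD ∘ v) i ⟨
    finToFun (parityCode v) i   ≡⟨ cong (λ c → finToFun c i) same ⟩
    finToFun (parityCode w) i   ≡⟨ FinP.finToFun-funToFin (parityD ∘ w) i ⟩
    parityD (w i)               ∎)

[i+i]+[j+j]≢2 : ∀ {i j} → 0ℤ < i → 0ℤ < j → (i + i) + (j + j) ≢ + 2
[i+i]+[j+j]≢2 {i} {j} 0<i 0<j sum≡2 = ℤP.≤⇒≯ (subst (+ 4 ≤_) sum≡2 4≤sum) (+<+ (s≤s (s≤s (s≤s z≤n))))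
  where
  1≤i : + 1 ≤ i
  1≤i = ℤP.i<j⇒suc[i]≤j 0<i
  1≤j : + 1 ≤ j
  1≤j = ℤP.i<j⇒suc[i]≤j 0<j
  4≤sum : + 4 ≤ (i + i) + (j + j)
  4≤sum = ℤP.+-mono-≤ (ℤP.+-mono-≤ 1≤i 1≤i) (ℤP.+-mono-≤ 1≤j 1≤j)

CongruentMod2∧ℓ≡1⇒evalQ-≡ : ∀ a {d r} {α : QForm r} → a ℕ.* a ℕ.≤ d → TotPosForm (+ d) r α →
  ∀ v w → CongruentMod2 v w →
  ℓ a (evalQ (+ d) r α v) ≡ + 1 → ℓ a (evalQ (+ d) r α w) ≡ + 1 →
  evalQ (+ d) r α v ≡ evalQ (+ d) r α w
CongruentMod2∧ℓ≡1⇒evalQ-≡ a {d} {r} {α} a²≤d Q≻0 v w (y , v≡x+y) ℓQv≡1 ℓQw≡1 =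
  conclude (FinP.all? λ i → x i ≟D zeroD) (FinP.all? λ i → y i ≟D zeroD)
  where
  open ≡-Reasoning
  Q : (Fin r → ZD) → ZD
  Q = evalQ (+ d) r α
  x : Fin r → ZD
  x i = w i +D y i
  w≡x-y : ∀ i → w i ≡ x i +D negD (y i)
  w≡x-y i = sym (+D-negD-cancelʳ (w i) (y i))
  0<ℓQ : ∀ z → ¬ (∀ i → z i ≡ zeroD) → 0ℤ < ℓ a (Q z)
  0<ℓQ z z≢0 = TotPos⇒0<ℓ a a²≤d (Q z) (Q≻0 z z≢0)
  ℓ-parallelogram : (ℓ a (Q x) + ℓ a (Q x)) + (ℓ a (Q y) + ℓ a (Q y)) ≡ + 2
  ℓ-parallelogram = begin
    (ℓ a (Q x) + ℓ a (Q x)) + (ℓ a (Q y) + ℓ a (Q y))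
      ≡⟨ cong₂ _+_ (ℓ-distrib-+D a (Q x) (Q x)) (ℓ-distrib-+D a (Q y) (Q y)) ⟨
    ℓ a (Q x +D Q x) + ℓ a (Q y +D Q y)
      ≡⟨ ℓ-distrib-+D a (Q x +D Q x) (Q y +D Q y) ⟨
    ℓ a ((Q x +D Q x) +D (Q y +D Q y))
      ≡⟨ cong (ℓ a) (evalQ-parallelogram (+ d) r α x y) ⟨
    ℓ a (Q (λ i → x i +D y i) +D Q (λ i → x i +D negD (y i)))
      ≡⟨ cong (ℓ a) (cong₂ _+D_ (evalQ-cong (+ d) r α v≡x+y) (evalQ-cong (+ d) r α w≡x-y)) ⟨
    ℓ a (Q v +D Q w)
      ≡⟨ ℓ-distrib-+D a (Q v) (Q w) ⟩
    ℓ a (Q v) + ℓ a (Q w)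
      ≡⟨ cong₂ _+_ ℓQv≡1 ℓQw≡1 ⟩
    + 2 ∎
  conclude : Dec (∀ i → x i ≡ zeroD) → Dec (∀ i → y i ≡ zeroD) → Q v ≡ Q w
  conclude (yes x≡0) _ = begin
    Q v          ≡⟨ evalQ-cong (+ d) r α v≡y ⟩
    Q y          ≡⟨ evalQ-negD (+ d) r α y ⟨
    Q (negD ∘ y) ≡⟨ evalQ-cong (+ d) r α w≡-y ⟨
    Q w          ∎
    where
    v≡y : ∀ i → v i ≡ y i
    v≡y i = trans (v≡x+y i) (trans (cong (_+D y i) (x≡0 i)) (+D-identityˡ (y i)))
    w≡-y : ∀ i → w i ≡ negD (y i)
    w≡-y i = trans (w≡x-y i) (trans (cong (_+D negD (y i)) (x≡0 i)) (+D-identityˡ (negD (y i))))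
  conclude (no _) (yes y≡0) = evalQ-cong (+ d) r α λ i → begin
    v i                       ≡⟨ v≡x+y i ⟩
    (w i +D y i) +D y i       ≡⟨ cong (λ δ → (w i +D δ) +D δ) (y≡0 i) ⟩
    (w i +D zeroD) +D zeroD   ≡⟨ trans (+D-identityʳ _) (+D-identityʳ (w i)) ⟩
    w i                       ∎
  conclude (no x≢0) (no y≢0) =
    contradiction ℓ-parallelogram ([i+i]+[j+j]≢2 (0<ℓQ x x≢0) (0<ℓQ y y≢0))

ℓ≡1-values≤4^rank : ∀ a {d r k} {α : QForm r} → a ℕ.* a ℕ.≤ d → TotPosForm (+ d) r α →
  (v : Fin k → Fin r → ZD) → (∀ t → ℓ a (evalQ (+ d) r α (v t)) ≡ + 1) →
  Injective _≡_ _≡_ (evalQ (+ d) r α ∘ v) → k ℕ.≤ 4 ℕ.^ r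
ℓ≡1-values≤4^rank a {α = α} a²≤d Q≻0 v ℓ≡1 injective = ℕP.≮⇒≥ λ 4^r<k →
  let t , t′ , t<t′ , sameCode = FinP.pigeonhole 4^r<k (parityCode ∘ v)
  in FinP.<-irrefl (injective (CongruentMod2∧ℓ≡1⇒evalQ-≡ a {α = α} a²≤d Q≻0 (v t) (v t′)
       (parityCode-≡⇒CongruentMod2 (v t) (v t′) sameCode) (ℓ≡1 t) (ℓ≡1 t′))) t<t′

β : ℕ → ℕ → ZD
β a t = + suc (t ℕ.* a) , + t

ℓ-β : ∀ a t → ℓ a (β a t) ≡ + 1
ℓ-β a t = begin
  + suc (t ℕ.* a) - + a * + t   ≡⟨ cong (λ ta → + 1 + ta - + a * + t) (ℤP.pos-* t a) ⟩
  + 1 + + t * + a - + a * + t   ≡⟨ cancel (+ t) (+ a) ⟩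
  + 1                           ∎
  where
  open ≡-Reasoning
  cancel : ∀ x y → + 1 + x * y - y * x ≡ + 1
  cancel = solve-∀

β-injective : ∀ a {t t′} → β a t ≡ β a t′ → t ≡ t′
β-injective a = ℤP.+-injective ∘ cong proj₂

[a²+b]t²<[1+ta]² : ∀ a b t → b ℕ.* t ℕ.≤ a →
  (a ℕ.* a ℕ.+ b) ℕ.* (t ℕ.* t) ℕ.< suc (t ℕ.* a) ℕ.* suc (t ℕ.* a)
[a²+b]t²<[1+ta]² a b t bt≤a = begin-strict
  (a ℕ.* a ℕ.+ b) ℕ.* (t ℕ.* t)
    ≡⟨ ℕSolver.solve (a ∷ b ∷ t ∷ []) ⟩
  (t ℕ.* a) ℕ.* (t ℕ.* a) ℕ.+ (b ℕ.* t) ℕ.* t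
    ≤⟨ ℕP.+-monoʳ-≤ ((t ℕ.* a) ℕ.* (t ℕ.* a)) (ℕP.*-monoˡ-≤ t bt≤a) ⟩
  (t ℕ.* a) ℕ.* (t ℕ.* a) ℕ.+ a ℕ.* t
    <⟨ s≤s (ℕP.m≤m+n _ (t ℕ.* a)) ⟩
  suc ((t ℕ.* a) ℕ.* (t ℕ.* a) ℕ.+ a ℕ.* t ℕ.+ t ℕ.* a)
    ≡⟨ ℕSolver.solve (a ∷ t ∷ []) ⟩
  suc (t ℕ.* a) ℕ.* suc (t ℕ.* a) ∎
  where open ℕP.≤-Reasoning

β-totallyPositive : ∀ a b t → b ℕ.* t ℕ.≤ a → TotPos (+ (a ℕ.* a ℕ.+ b)) (β a t)
β-totallyPositive a b zero    _    = β>0 , β>0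
  where
  β>0 : PosReal (+ (a ℕ.* a ℕ.+ b)) (+ 1 , + 0)
  β>0 = inj₁ (+≤+ z≤n , inj₁ (+<+ (s≤s z≤n)))
β-totallyPositive a b t@(suc _) bt≤a =
  inj₁ (+≤+ z≤n , inj₁ (+<+ (s≤s z≤n))) ,
  inj₂ (-<+ , +<+ (s≤s z≤n) ,
        subst (_< _) (ℤP.pos-* (a ℕ.* a ℕ.+ b) (t ℕ.* t)) (+<+ ([a²+b]t²<[1+ta]² a b t bt≤a)))

universal⇒K≤4^rank : ∀ a b K {r} {α : QForm r} → b ℕ.* K ℕ.≤ a →
  Universal (+ (a ℕ.* a ℕ.+ b)) r α → K ℕ.≤ 4 ℕ.^ r
universal⇒K≤4^rank a b K {r} {α} bK≤a (Q≻0 , universal) =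
  ℓ≡1-values≤4^rank a {α = α} (ℕP.m≤m+n (a ℕ.* a) b) Q≻0 (proj₁ ∘ represent) ℓ≡1 injective
  where
  Q : (Fin r → ZD) → ZD
  Q = evalQ (+ (a ℕ.* a ℕ.+ b)) r α
  represent : (t : Fin K) → Σ (Fin r → ZD) λ x → Q x ≡ β a (toℕ t)
  represent t = universal (β a (toℕ t)) (β-totallyPositive a b (toℕ t)
    (ℕP.≤-trans (ℕP.*-monoʳ-≤ b (ℕP.<⇒≤ (FinP.toℕ<n t))) bK≤a))
  ℓ≡1 : ∀ t → ℓ a (Q (proj₁ (represent t))) ≡ + 1
  ℓ≡1 t = trans (cong (ℓ a) (proj₂ (represent t))) (ℓ-β a (toℕ t))
  injective : Injective _≡_ _≡_ (Q ∘ proj₁ ∘ represent)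
  injective {t} {t′} same = FinP.toℕ-injective (β-injective a
    (trans (sym (proj₂ (represent t))) (trans same (proj₂ (represent t′)))))

between-squares⇒¬IsSquare : ∀ {a d} → a ℕ.* a ℕ.< d → d ℕ.< suc a ℕ.* suc a → ¬ IsSquare (+ d)
between-squares⇒¬IsSquare {a} {d} a²<d d<[1+a]² (k , k²≡d) = ℕP.<⇒≱ ∣k∣<1+a a<∣k∣
  where
  ∣k∣²≡d : ∣ k ∣ ℕ.* ∣ k ∣ ≡ d
  ∣k∣²≡d = trans (sym (ℤP.abs-* k k)) (cong ∣_∣ k²≡d)
  a<∣k∣ : a ℕ.< ∣ k ∣
  a<∣k∣ = m*m<n*n⇒m<n {a} {∣ k ∣} (subst (a ℕ.* a ℕ.<_) (sym ∣k∣²≡d) a²<d)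
  ∣k∣<1+a : ∣ k ∣ ℕ.< suc a
  ∣k∣<1+a = m*m<n*n⇒m<n {∣ k ∣} {suc a} (subst (ℕ._< suc a ℕ.* suc a) (sym ∣k∣²≡d) d<[1+a]²)

¬IsSquare[a²+b] : ∀ {a b} → 1 ℕ.≤ b → b ℕ.≤ a → ¬ IsSquare (+ (a ℕ.* a ℕ.+ b))
¬IsSquare[a²+b] {a} {b} 1≤b b≤a = between-squares⇒¬IsSquare {a} (ℕP.m<m+n (a ℕ.* a) 1≤b) d<[1+a]²
  where
  open ℕP.≤-Reasoning
  d<[1+a]² : a ℕ.* a ℕ.+ b ℕ.< suc a ℕ.* suc a
  d<[1+a]² = begin-strict
    a ℕ.* a ℕ.+ b             ≤⟨ ℕP.+-monoʳ-≤ (a ℕ.* a) b≤a ⟩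
    a ℕ.* a ℕ.+ a             <⟨ s≤s (ℕP.m≤m+n _ a) ⟩
    suc (a ℕ.* a ℕ.+ a ℕ.+ a) ≡⟨ ℕSolver.solve (a ∷ []) ⟩
    suc a ℕ.* suc a           ∎

n∣i-i%ℕn : ∀ i n .{{_ : ℕ.NonZero n}} → + n Signed.∣ i - + (i %ℕ n)
n∣i-i%ℕn i n = Signed.divides (i /ℕ n) (begin
  i - + (i %ℕ n)                                ≡⟨ cong (_- + (i %ℕ n)) (a≡a%ℕn+[a/ℕn]*n i n) ⟩
  + (i %ℕ n) + (i /ℕ n) * + n - + (i %ℕ n)      ≡⟨ cancel (+ (i %ℕ n)) _ ⟩
  (i /ℕ n) * + n                                ∎)
  where
  open ≡-Reasoning
  cancel : ∀ ρ x → ρ + x - ρ ≡ x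
  cancel = solve-∀

residue₁ : ℤ → (n : ℕ) → .{{ℕ.NonZero n}} → ℕ
residue₁ m n = suc ((m - + 1) %ℕ n)

residue₁≤n : ∀ m n .{{_ : ℕ.NonZero n}} → residue₁ m n ℕ.≤ n
residue₁≤n m n = n%ℕd<d (m - + 1) n

n∣residue₁-m : ∀ m n .{{_ : ℕ.NonZero n}} → + n Signed.∣ + residue₁ m n - m
n∣residue₁-m m n = subst (+ n Signed.∣_) (shift m (+ ((m - + 1) %ℕ n)))
  (Signed.∣m⇒∣-m (n∣i-i%ℕn (m - + 1) n))
  where
  shift : ∀ m ρ → - ((m - + 1) - ρ) ≡ (+ 1 + ρ) - m
  shift = solve-∀

n∣[a²+residue₁]-m : ∀ m n a .{{_ : ℕ.NonZero n}} → n ℕDiv.∣ a →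
  + n ∣ + (a ℕ.* a ℕ.+ residue₁ m n) - m
n∣[a²+residue₁]-m m n a n∣a =
  Signed.∣⇒∣ᵤ (subst (+ n Signed.∣_) (sym (ℤP.+-assoc (+ (a ℕ.* a)) (+ residue₁ m n) (- m)))
    (Signed.∣m∣n⇒∣m+n (Signed.∣ᵤ⇒∣ {+ n} {+ (a ℕ.* a)} (ℕDiv.∣m⇒∣m*n a n∣a)) (n∣residue₁-m m n)))

bᵐ≤bⁿ⇒m≤n : ∀ b {m n} → 1 ℕ.< b → b ℕ.^ m ℕ.≤ b ℕ.^ n → m ℕ.≤ n
bᵐ≤bⁿ⇒m≤n b 1<b bᵐ≤bⁿ = ℕP.≮⇒≥ λ n<m → ℕP.<⇒≱ (ℕP.^-monoʳ-< b 1<b n<m) bᵐ≤bⁿ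

i≤+∣i∣ : ∀ i → i ≤ + ∣ i ∣
i≤+∣i∣ (+ n)    = ℤP.≤-refl
i≤+∣i∣ -[1+ n ] = -≤+

theorem4p6 : (m s : ℤ) (n : ℕ) → 1 ℕ.≤ n →
    Σ ℤ λ D → (+ 2 ≤ D) × (¬ IsSquare D) × ((+ n) ∣ (D - m)) ×
      ((r : ℕ) (α : QForm r) → Universal D r α → s ≤ + r)
theorem4p6 m s n 1≤n =
  + (a ℕ.* a ℕ.+ b) , +≤+ 2≤d , ¬IsSquare[a²+b] 1≤b b≤a ,
  n∣[a²+residue₁]-m m n a (ℕDiv.m∣m*n K) , s≤rank
  where
  instance
    n≢0 : ℕ.NonZero n
    n≢0 = ℕ.>-nonZero 1≤n
    K≢0 : ℕ.NonZero (4 ℕ.^ ∣ s ∣)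
    K≢0 = ℕP.m^n≢0 4 ∣ s ∣
  K a b : ℕ
  K = 4 ℕ.^ ∣ s ∣
  a = n ℕ.* K
  b = residue₁ m n
  1≤b : 1 ℕ.≤ b
  1≤b = s≤s z≤n
  b≤a : b ℕ.≤ a
  b≤a = ℕP.≤-trans (residue₁≤n m n) (ℕP.m≤m*n n K)
  2≤d : 2 ℕ.≤ a ℕ.* a ℕ.+ b
  2≤d = ℕP.+-mono-≤ (ℕP.*-mono-≤ (ℕP.≤-trans 1≤b b≤a) (ℕP.≤-trans 1≤b b≤a)) 1≤b
  s≤rank : (r : ℕ) (α : QForm r) → Universal (+ (a ℕ.* a ℕ.+ b)) r α → s ≤ + r
  s≤rank r α universal = ℤP.≤-trans (i≤+∣i∣ s) (+≤+ (bᵐ≤bⁿ⇒m≤n 4 (s≤s (s≤s z≤n))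
    (universal⇒K≤4^rank a b K {α = α} (ℕP.*-monoˡ-≤ K (residue₁≤n m n)) universal)))
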